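{- Let $K\ge2$, $L\ge1$, and let $\widetilde{\alpha}$ be a $P^{(K)}_L$-sequence on the alphabet $[K]=\{0,\dots,K-1\}$. Then for every integer $m$ with $1\le m \leq L$, every length-$m$ string on $[K]$ occurs, in total over the family of necklaces comprising Lempel's lift of $\widetilde{\alpha}$, either $\lfloor L/K^{m-1}\rfloor$ or $\lceil L/K^{m-1}\rceil$ times as a substring.
   Context: A necklace of length $L$ is a cyclic sequence of $L$ characters; indices are taken modulo $L$. The number of occurrences of a length-$m$ string $\omega$ as a substring of a necklace $\widetilde{\gamma}$ of length $n\ge m$ is the number of $i\in\{0,\dots,n-1\}$ with $\widetilde{\gamma}[i+t]=\omega[t]$ for all $t<m$; for a family of necklaces it is the sum over members. A $P^{(K)}_L$-sequence on $[K]$ is a length-$L$ necklace on $[K]$ such that for every $m\le L$ every length-$m$ string on $[K]$ occurs $\lfloor L/K^m\rfloor$ or $\lceil L/K^m\rceil$ times as a substring of it. Lempel's lift of a length-$L$ necklace $\widetilde{\beta}$ on $[K]$: let $d$ be the smallest positive integer with $d\cdot\sum_{j=0}^{L-1}\widetilde{\beta}[j]$ divisible by $K$, and $p=K/d$; the lift is the family $\{\widetilde{\lambda}_i: i\in\{0,\dots,p-1\}\}$ of length-$dL$ necklaces $\widetilde{\lambda}_i = \big(i+\widetilde{\beta}[0],\ i+\widetilde{\beta}[0]+\widetilde{\beta}[1],\ \ldots,\ i+\sum_{j=0}^{dL-1}\widetilde{\beta}[j]\big)$ (cyclic, arithmetic modulo $K$, indices of $\widetilde{\beta}$ modulo $L$).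 -}

module Defs where

open import Data.Nat using (ℕ; zero; suc; _+_; _*_; _∸_; _^_; _≤_; _<_; NonZero)
open import Data.Nat.DivMod using (_/_; _%_; m%n<n)
open import Data.Nat.Divisibility using (_∣_)
open import Data.Nat.Properties using (m^n≢0; m*n≢0)
open import Data.Fin using (Fin; toℕ; fromℕ<)
open import Data.Fin.Properties using () renaming (_≟_ to _≟ᶠ_)
open import Data.Product using (_×_; Σ)
open import Data.Sum using (_⊎_)
open import Relation.Nullary using (Dec; yes; no; ¬_)
open import Relation.Binary.PropositionalEquality using (_≡_)

-- A necklace of length n on [K] is a map Fin n → Fin K (read cyclically).
Necklace : ℕ → ℕ → Set
Necklace K n = Fin n → Fin K

Str : ℕ → ℕ → Set
Str K m = Fin m → Fin K

at : ∀ {K n} .{{_ : NonZero n}} → Necklace K n → ℕ → Fin K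
at {n = n} γ i = γ (fromℕ< (m%n<n i n))

count : (n : ℕ) → (P : ℕ → Set) → ((i : ℕ) → Dec (P i)) → ℕ
count zero    P P? = 0
count (suc n) P P? with P? n
... | yes _ = suc (count n P P?)
... | no  _ = count n P P?

allFin? : ∀ m (Q : Fin m → Set) → ((t : Fin m) → Dec (Q t)) → Dec (∀ t → Q t)
allFin? zero Q Q? = yes (λ ())
allFin? (suc m) Q Q? with Q? Fin.zero | allFin? m (λ t → Q (Fin.suc t)) (λ t → Q? (Fin.suc t))
... | yes q0 | yes qs = yes (λ { Fin.zero → q0 ; (Fin.suc t) → qs t })
... | no ¬q0 | _      = no (λ f → ¬q0 (f Fin.zero))
... | yes _  | no ¬qs = no (λ f → ¬qs (λ t → f (Fin.suc t)))

OccursAt : ∀ {K n m} .{{_ : NonZero n}} → Necklace K n → Str K m → ℕ → Set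
OccursAt {m = m} γ ω i = (t : Fin m) → at γ (i + toℕ t) ≡ ω t

occursAt? : ∀ {K n m} .{{_ : NonZero n}} (γ : Necklace K n) (ω : Str K m) (i : ℕ) → Dec (OccursAt γ ω i)
occursAt? {m = m} γ ω i = allFin? m _ (λ t → at γ (i + toℕ t) ≟ᶠ ω t)

occ : ∀ {K n m} .{{_ : NonZero n}} → Necklace K n → Str K m → ℕ
occ {n = n} γ ω = count n (OccursAt γ ω) (occursAt? γ ω)

sumBelow : ℕ → (ℕ → ℕ) → ℕ
sumBelow zero    f = 0
sumBelow (suc p) f = sumBelow p f + f p

⌈_/_⌉ : (a b : ℕ) .{{_ : NonZero b}} → ℕ
⌈ a / b ⌉ = (a + b ∸ 1) / b

FloorOrCeil : ℕ → (a b : ℕ) .{{_ : NonZero b}} → Set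
FloorOrCeil c a b = c ≡ a / b ⊎ c ≡ ⌈ a / b ⌉

IsPSeq : (K L : ℕ) .{{_ : NonZero K}} .{{_ : NonZero L}} → Necklace K L → Set
IsPSeq K L α = (m : ℕ) → m ≤ L → (ω : Str K m) →
  FloorOrCeil (occ α ω) L (K ^ m) {{m^n≢0 K m}}

necklaceSum : ∀ {K L} .{{_ : NonZero L}} → Necklace K L → ℕ
necklaceSum {L = L} β = sumBelow L (λ j → toℕ (at β j))

IsLiftDegree : ∀ {K L} .{{_ : NonZero L}} → Necklace K L → ℕ → Set
IsLiftDegree {K} β d =
  (0 < d × K ∣ d * necklaceSum β) × (∀ d′ → 0 < d′ → K ∣ d′ * necklaceSum β → d ≤ d′)

-- i-th member of Lempel's lift (with lift degree d): the necklace of length d*L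
-- whose j-th entry is (i + β[0] + ... + β[j]) mod K, indices of β modulo L
liftNecklace : (K L d : ℕ) .{{_ : NonZero K}} .{{_ : NonZero L}} →
  Necklace K L → ℕ → Necklace K (d * L)
liftNecklace K L d β i j =
  fromℕ< (m%n<n (i + sumBelow (suc (toℕ j)) (λ t → toℕ (at β t))) K)

liftOcc : (K L d : ℕ) .{{_ : NonZero K}} .{{_ : NonZero L}} .{{_ : NonZero d}} →
  Necklace K L → ∀ {m} → Str K m → ℕ
liftOcc K L d β ω =
  sumBelow (K / d) (λ i → occ {{nonZeroProd}} (liftNecklace K L d β i) ω)
  where nonZeroProd = m*n≢0 d L

{-# OPTIONS --safe #-}
module Submission where

-- Every member λᵢ of the lift is a running sum of α modulo K, so ω occurs in λᵢ at j
-- exactly when λᵢ[j] = ω[0] and the word of consecutive differences of ω occurs in α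
-- at j + 1. Write j = kL + r and S for the digit sum of α: then λᵢ[j] is i + kS + c
-- modulo K, with c depending only on r. Since d is the additive order of S modulo K,
-- K/d divides S and the values i + kS + c (k < d, i < K/d) are pairwise distinct
-- modulo K, hence hit every residue exactly once. So the lift contains ω exactly as
-- often as α contains its difference word, of length m - 1, and the P-sequence
-- property of α applies to that word.

open import Defs
open import Data.Nat
open import Data.Nat.Properties
open import Data.Nat.DivMod
open import Data.Nat.Divisibility
open import Data.Fin as Fin using (toℕ; fromℕ<; inject₁)
open import Data.Fin.Properties using (toℕ-injective; toℕ-fromℕ<; toℕ<n; toℕ-inject₁)
open import Data.Fin.Induction using (<-weakInduction)
open import Data.Product using (_×_; _,_; proj₁; proj₂)
open import Data.Sum using (inj₁; inj₂)
open import Function.Base using (_∘_)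
open import Function.Bundles using (_⇔_; mk⇔; Equivalence)
open import Relation.Nullary using (Dec; yes; no; contradiction)
open import Relation.Binary.PropositionalEquality
open ≡-Reasoning
open import Algebra.Properties.CommutativeSemigroup +-commutativeSemigroup using (interchange; x∙yz≈y∙xz; x∙yz≈xz∙y)

sumBelow-cong : ∀ n {f g : ℕ → ℕ} → (∀ u → u < n → f u ≡ g u) → sumBelow n f ≡ sumBelow n g
sumBelow-cong zero    eq = refl
sumBelow-cong (suc n) eq = cong₂ _+_ (sumBelow-cong n (λ u u<n → eq u (m<n⇒m<1+n u<n))) (eq n ≤-refl)

sumBelow-const : ∀ n c → sumBelow n (λ _ → c) ≡ n * c
sumBelow-const zero    c = refl
sumBelow-const (suc n) c = trans (cong (_+ c) (sumBelow-const n c)) (+-comm (n * c) c)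

sumBelow-≡0 : ∀ n {f : ℕ → ℕ} → (∀ u → u < n → f u ≡ 0) → sumBelow n f ≡ 0
sumBelow-≡0 n eq = trans (sumBelow-cong n eq) (trans (sumBelow-const n 0) (*-zeroʳ n))

sumBelow-mono-≤ : ∀ n {f g : ℕ → ℕ} → (∀ u → u < n → f u ≤ g u) → sumBelow n f ≤ sumBelow n g
sumBelow-mono-≤ zero    le = z≤n
sumBelow-mono-≤ (suc n) le = +-mono-≤ (sumBelow-mono-≤ n (λ u u<n → le u (m<n⇒m<1+n u<n))) (le n ≤-refl)

sumBelow-distrib-+ : ∀ n (f g : ℕ → ℕ) → sumBelow n (λ u → f u + g u) ≡ sumBelow n f + sumBelow n g
sumBelow-distrib-+ zero    f g = refl
sumBelow-distrib-+ (suc n) f g = begin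
  sumBelow n (λ u → f u + g u) + (f n + g n)  ≡⟨ cong (_+ (f n + g n)) (sumBelow-distrib-+ n f g) ⟩
  (sumBelow n f + sumBelow n g) + (f n + g n) ≡⟨ interchange (sumBelow n f) (sumBelow n g) (f n) (g n) ⟩
  (sumBelow n f + f n) + (sumBelow n g + g n) ∎

sumBelow-*ʳ : ∀ n (f : ℕ → ℕ) c → sumBelow n (λ u → f u * c) ≡ sumBelow n f * c
sumBelow-*ʳ zero    f c = refl
sumBelow-*ʳ (suc n) f c = trans (cong (_+ f n * c) (sumBelow-*ʳ n f c)) (sym (*-distribʳ-+ c (sumBelow n f) (f n)))

sumBelow-comm : ∀ m n (f : ℕ → ℕ → ℕ) →
  sumBelow m (λ i → sumBelow n (f i)) ≡ sumBelow n (λ j → sumBelow m (λ i → f i j))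
sumBelow-comm zero    n f = sym (sumBelow-≡0 n (λ _ _ → refl))
sumBelow-comm (suc m) n f = begin
  sumBelow m (λ i → sumBelow n (f i)) + sumBelow n (f m)        ≡⟨ cong (_+ sumBelow n (f m)) (sumBelow-comm m n f) ⟩
  sumBelow n (λ j → sumBelow m (λ i → f i j)) + sumBelow n (f m) ≡⟨ sumBelow-distrib-+ n _ (f m) ⟨
  sumBelow n (λ j → sumBelow m (λ i → f i j) + f m j)           ∎

sumBelow-+ : ∀ m n (f : ℕ → ℕ) → sumBelow (m + n) f ≡ sumBelow m f + sumBelow n (λ u → f (m + u))
sumBelow-+ m zero    f = trans (cong (λ k → sumBelow k f) (+-identityʳ m)) (sym (+-identityʳ _))
sumBelow-+ m (suc n) f = begin
  sumBelow (m + suc n) f                                        ≡⟨ cong (λ k → sumBelow k f) (+-suc m n) ⟩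
  sumBelow (m + n) f + f (m + n)                                ≡⟨ cong (_+ f (m + n)) (sumBelow-+ m n f) ⟩
  sumBelow m f + sumBelow n (λ u → f (m + u)) + f (m + n)       ≡⟨ +-assoc (sumBelow m f) _ _ ⟩
  sumBelow m f + (sumBelow n (λ u → f (m + u)) + f (m + n))     ∎

sumBelow-blocks : ∀ k n (f : ℕ → ℕ) → sumBelow (k * n) f ≡ sumBelow k (λ b → sumBelow n (λ r → f (b * n + r)))
sumBelow-blocks zero    n f = refl
sumBelow-blocks (suc k) n f = begin
  sumBelow (n + k * n) f
    ≡⟨ cong (λ m → sumBelow m f) (+-comm n (k * n)) ⟩
  sumBelow (k * n + n) f
    ≡⟨ sumBelow-+ (k * n) n f ⟩
  sumBelow (k * n) f + sumBelow n (λ r → f (k * n + r))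
    ≡⟨ cong (_+ sumBelow n (λ r → f (k * n + r))) (sumBelow-blocks k n f) ⟩
  sumBelow k (λ b → sumBelow n (λ r → f (b * n + r))) + sumBelow n (λ r → f (k * n + r))
    ∎

sumBelow-shift : ∀ n (f : ℕ → ℕ) → f n ≡ f 0 → sumBelow n (λ u → f (suc u)) ≡ sumBelow n f
sumBelow-shift n f fn≡f0 = +-cancelˡ-≡ (f 0) _ _ (begin
  f 0 + sumBelow n (λ u → f (suc u)) ≡⟨ sumBelow-+ 1 n f ⟨
  sumBelow (suc n) f                  ≡⟨ cong (sumBelow n f +_) fn≡f0 ⟩
  sumBelow n f + f 0                  ≡⟨ +-comm (sumBelow n f) (f 0) ⟩
  f 0 + sumBelow n f                  ∎)

indicator : ∀ {P : Set} → Dec P → ℕ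
indicator (yes _) = 1
indicator (no _)  = 0

indicator-cong : ∀ {P Q : Set} (P? : Dec P) (Q? : Dec Q) → P ⇔ Q → indicator P? ≡ indicator Q?
indicator-cong (yes _) (yes _) P⇔Q = refl
indicator-cong (no _)  (no _)  P⇔Q = refl
indicator-cong (yes p) (no ¬q) P⇔Q = contradiction (Equivalence.to P⇔Q p) ¬q
indicator-cong (no ¬p) (yes q) P⇔Q = contradiction (Equivalence.from P⇔Q q) ¬p

indicator-× : ∀ {P Q R : Set} (P? : Dec P) (Q? : Dec Q) (R? : Dec R) → P ⇔ (Q × R) →
  indicator P? ≡ indicator Q? * indicator R?
indicator-× P? (yes q) (yes r) P⇔Q×R = indicator-cong P? (yes (q , r)) P⇔Q×R
indicator-× P? (yes q) (no ¬r) P⇔Q×R = indicator-cong P? (no (¬r ∘ proj₂)) P⇔Q×R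
indicator-× P? (no ¬q) R?      P⇔Q×R = indicator-cong P? (no (¬q ∘ proj₁)) P⇔Q×R

count≡sumBelow-indicator : ∀ n (P : ℕ → Set) (P? : ∀ i → Dec (P i)) →
  count n P P? ≡ sumBelow n (λ i → indicator (P? i))
count≡sumBelow-indicator zero    P P? = refl
count≡sumBelow-indicator (suc n) P P? with P? n
... | yes _ = trans (cong suc (count≡sumBelow-indicator n P P?)) (+-comm 1 _)
... | no  _ = trans (count≡sumBelow-indicator n P P?) (sym (+-identityʳ _))

sumBelow-indicator≤1 : ∀ n {P : ℕ → Set} (P? : ∀ i → Dec (P i)) →
  (∀ {x y} → x < n → y < n → P x → P y → x ≡ y) → sumBelow n (λ i → indicator (P? i)) ≤ 1
sumBelow-indicator≤1 zero    P? unique = z≤n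
sumBelow-indicator≤1 (suc n) P? unique with P? n
... | yes pn = ≤-reflexive (cong (_+ 1) (sumBelow-≡0 n no-other))
  where
  no-other : ∀ x → x < n → indicator (P? x) ≡ 0
  no-other x x<n with P? x
  ... | yes px = contradiction (unique (m<n⇒m<1+n x<n) ≤-refl px pn) (<⇒≢ x<n)
  ... | no  _  = refl
... | no  _  = subst (_≤ 1) (sym (+-identityʳ _))
  (sumBelow-indicator≤1 n P? (λ x<n y<n → unique (m<n⇒m<1+n x<n) (m<n⇒m<1+n y<n)))

sumBelow-indicator-≡ : ∀ n v → v < n → sumBelow n (λ w → indicator (v ≟ w)) ≡ 1
sumBelow-indicator-≡ (suc n) v v<1+n with v ≟ n
... | yes refl = cong (_+ 1) (sumBelow-≡0 n no-other)
  where
  no-other : ∀ w → w < n → indicator (n ≟ w) ≡ 0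
  no-other w w<n with n ≟ w
  ... | yes refl = contradiction w<n (<-irrefl refl)
  ... | no  _    = refl
... | no  v≢n  = trans (+-identityʳ _) (sumBelow-indicator-≡ n v (≤∧≢⇒< (≤-pred v<1+n) v≢n))

sumBelow≡n⇒≡1 : ∀ n (f : ℕ → ℕ) → (∀ u → u < n → f u ≤ 1) → sumBelow n f ≡ n →
  ∀ u → u < n → f u ≡ 1
sumBelow≡n⇒≡1 (suc n) f f≤1 Σf≡1+n u u<1+n with Σ≡n-and-last≡1 (f≤1 n ≤-refl) Σf≡1+n
  where
  f≤1′ : ∀ u → u < n → f u ≤ 1
  f≤1′ u u<n = f≤1 u (m<n⇒m<1+n u<n)

  Σ≤n : sumBelow n f ≤ n
  Σ≤n = subst (sumBelow n f ≤_) (trans (sumBelow-const n 1) (*-identityʳ n)) (sumBelow-mono-≤ n f≤1′)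

  Σ≡n-and-last≡1 : ∀ {b} → b ≤ 1 → sumBelow n f + b ≡ suc n → sumBelow n f ≡ n × b ≡ 1
  Σ≡n-and-last≡1 z≤n       eq = contradiction (subst (_≤ n) (trans (sym (+-identityʳ _)) eq) Σ≤n) 1+n≰n
  Σ≡n-and-last≡1 (s≤s z≤n) eq = +-cancelʳ-≡ 1 _ n (trans eq (+-comm 1 n)) , refl
... | Σ≡n , fn≡1 with u ≟ n
...   | yes refl = fn≡1
...   | no  u≢n  = sumBelow≡n⇒≡1 n f (λ v v<n → f≤1 v (m<n⇒m<1+n v<n)) Σ≡n u (≤∧≢⇒< (≤-pred u<1+n) u≢n)

injective⇒fibre≡1 : ∀ n (f : ℕ → ℕ) → (∀ x → x < n → f x < n) →
  (∀ {x y} → x < n → y < n → f x ≡ f y → x ≡ y) →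
  ∀ w → w < n → sumBelow n (λ x → indicator (f x ≟ w)) ≡ 1
injective⇒fibre≡1 n f f<n injective = sumBelow≡n⇒≡1 n fibre fibre≤1 fibres-cover
  where
  fibre : ℕ → ℕ
  fibre w = sumBelow n (λ x → indicator (f x ≟ w))

  fibre≤1 : ∀ w → w < n → fibre w ≤ 1
  fibre≤1 w _ = sumBelow-indicator≤1 n (λ x → f x ≟ w)
    (λ x<n y<n fx≡w fy≡w → injective x<n y<n (trans fx≡w (sym fy≡w)))

  fibres-cover : sumBelow n fibre ≡ n
  fibres-cover = begin
    sumBelow n fibre
      ≡⟨ sumBelow-comm n n (λ w x → indicator (f x ≟ w)) ⟩
    sumBelow n (λ x → sumBelow n (λ w → indicator (f x ≟ w)))
      ≡⟨ sumBelow-cong n (λ x x<n → sumBelow-indicator-≡ n (f x) (f<n x x<n)) ⟩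
    sumBelow n (λ _ → 1)                                      ≡⟨ sumBelow-const n 1 ⟩
    n * 1                                                     ≡⟨ *-identityʳ n ⟩
    n                                                         ∎

%≡%⇒∣∸ : ∀ m o n .{{_ : NonZero n}} → m % n ≡ o % n → n ∣ m ∸ o
%≡%⇒∣∸ m o n m%n≡o%n = divides (m / n ∸ o / n) (begin
  m ∸ o                                     ≡⟨ cong₂ _∸_ (m≡m%n+[m/n]*n m n) (m≡m%n+[m/n]*n o n) ⟩
  (m % n + m / n * n) ∸ (o % n + o / n * n) ≡⟨ cong (λ r → (m % n + m / n * n) ∸ (r + o / n * n)) m%n≡o%n ⟨
  (m % n + m / n * n) ∸ (m % n + o / n * n) ≡⟨ [m+n]∸[m+o]≡n∸o (m % n) _ _ ⟩
  m / n * n ∸ o / n * n                     ≡⟨ *-distribʳ-∸ n (m / n) (o / n) ⟨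
  (m / n ∸ o / n) * n                       ∎)

∣∸⇒%≡% : ∀ {m o} n .{{_ : NonZero n}} → o ≤ m → n ∣ m ∸ o → m % n ≡ o % n
∣∸⇒%≡% {m} {o} n o≤m n∣m∸o = trans (cong (_% n) (sym (m+[n∸m]≡n o≤m))) (%-remove-+ʳ o n∣m∸o)

%-cancelˡ-+ : ∀ c a b n .{{_ : NonZero n}} → (c + a) % n ≡ (c + b) % n → a % n ≡ b % n
%-cancelˡ-+ c a b n eq with ≤-total b a
... | inj₁ b≤a = ∣∸⇒%≡% n b≤a (subst (n ∣_) ([m+n]∸[m+o]≡n∸o c a b) (%≡%⇒∣∸ (c + a) (c + b) n eq))
... | inj₂ a≤b = sym (∣∸⇒%≡% n a≤b
  (subst (n ∣_) ([m+n]∸[m+o]≡n∸o c b a) (%≡%⇒∣∸ (c + b) (c + a) n (sym eq))))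

%-cancelʳ-+ : ∀ c a b n .{{_ : NonZero n}} → (a + c) % n ≡ (b + c) % n → a % n ≡ b % n
%-cancelʳ-+ c a b n eq = %-cancelˡ-+ c a b n (trans (cong (_% n) (+-comm c a)) (trans eq (cong (_% n) (+-comm b c))))

[m+n%k]%k≡[m+n]%k : ∀ m n k .{{_ : NonZero k}} → (m + n % k) % k ≡ (m + n) % k
[m+n%k]%k≡[m+n]%k m n k = sym (begin
  (m + n) % k                   ≡⟨ cong (λ x → (m + x) % k) (m≡m%n+[m/n]*n n k) ⟩
  (m + (n % k + n / k * k)) % k ≡⟨ cong (_% k) (+-assoc m (n % k) _) ⟨
  (m + n % k + n / k * k) % k   ≡⟨ [m+kn]%n≡m%n (m + n % k) (n / k) k ⟩
  (m + n % k) % k               ∎)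

[m%k+n]%k≡[m+n]%k : ∀ m n k .{{_ : NonZero k}} → (m % k + n) % k ≡ (m + n) % k
[m%k+n]%k≡[m+n]%k m n k = begin
  (m % k + n) % k ≡⟨ cong (_% k) (+-comm (m % k) n) ⟩
  (n + m % k) % k ≡⟨ [m+n%k]%k≡[m+n]%k n m k ⟩
  (n + m) % k     ≡⟨ cong (_% k) (+-comm n m) ⟩
  (m + n) % k     ∎

module Residues (K : ℕ) .{{_ : NonZero K}} where

  _⊖_ : ℕ → ℕ → ℕ
  n ⊖ m = (n + (K ∸ m)) % K

  ⊖<K : ∀ n m → n ⊖ m < K
  ⊖<K n m = m%n<n (n + (K ∸ m)) K

  m+[n⊖m]≡n : ∀ {m n} → m < K → n < K → (m + (n ⊖ m)) % K ≡ n
  m+[n⊖m]≡n {m} {n} m<K n<K = begin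
    (m + (n + (K ∸ m)) % K) % K ≡⟨ [m+n%k]%k≡[m+n]%k m _ K ⟩
    (m + (n + (K ∸ m))) % K     ≡⟨ cong (_% K) (x∙yz≈y∙xz m n (K ∸ m)) ⟩
    (n + (m + (K ∸ m))) % K     ≡⟨ cong (λ x → (n + x) % K) (m+[n∸m]≡n (<⇒≤ m<K)) ⟩
    (n + K) % K                 ≡⟨ [m+n]%n≡m%n n K ⟩
    n % K                       ≡⟨ m<n⇒m%n≡m n<K ⟩
    n                           ∎

  [m+o]%K≡n⇒o≡n⊖m : ∀ {m n o} → m < K → o < K → (m + o) % K ≡ n → o ≡ n ⊖ m
  [m+o]%K≡n⇒o≡n⊖m {m} {n} {o} m<K o<K [m+o]%K≡n = begin
    o                 ≡⟨ m<n⇒m%n≡m o<K ⟨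
    o % K             ≡⟨ %-cancelˡ-+ m o (n ⊖ m) K (trans [m+o]%K≡n (sym (m+[n⊖m]≡n m<K n<K))) ⟩
    (n ⊖ m) % K       ≡⟨ m%n%n≡m%n (n + (K ∸ m)) K ⟩
    n ⊖ m             ∎
    where
    n<K : n < K
    n<K = subst (_< K) [m+o]%K≡n (m%n<n (m + o) K)

module AdditiveOrder {K S d : ℕ} .{{_ : NonZero K}} .{{_ : NonZero d}}
  (K∣d*S : K ∣ d * S) (least : ∀ d′ → 0 < d′ → K ∣ d′ * S → d ≤ d′) where

  <-order⇒≡0 : ∀ {e} → e < d → K ∣ e * S → e ≡ 0
  <-order⇒≡0 {zero}  _   _      = refl
  <-order⇒≡0 {suc e} e<d K∣e*S = contradiction (least (suc e) z<s K∣e*S) (<⇒≱ e<d)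

  order∣modulus : d ∣ K
  order∣modulus = m%n≡0⇒n∣m K d (<-order⇒≡0 (m%n<n K d) K∣[K%d]*S)
    where
    K*S≡ : K * S ≡ K / d * (d * S) + K % d * S
    K*S≡ = begin
      K * S                           ≡⟨ cong (_* S) (m≡m%n+[m/n]*n K d) ⟩
      (K % d + K / d * d) * S         ≡⟨ *-distribʳ-+ S (K % d) (K / d * d) ⟩
      K % d * S + K / d * d * S       ≡⟨ +-comm (K % d * S) _ ⟩
      K / d * d * S + K % d * S       ≡⟨ cong (_+ K % d * S) (*-assoc (K / d) d S) ⟩
      K / d * (d * S) + K % d * S     ∎
    K∣[K%d]*S : K ∣ K % d * S
    K∣[K%d]*S = ∣m+n∣m⇒∣n (subst (K ∣_) K*S≡ (m∣m*n S)) (∣n⇒∣m*n (K / d) K∣d*S)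

  K≡[K/d]*d : K ≡ K / d * d
  K≡[K/d]*d = sym (m/n*n≡m order∣modulus)

  instance
    K/d≢0 : NonZero (K / d)
    K/d≢0 = >-nonZero (m≥n⇒m/n>0 (∣⇒≤ order∣modulus))

  [K/d]∣S : K / d ∣ S
  [K/d]∣S = *-cancelʳ-∣ d (subst (_∣ S * d) K≡[K/d]*d (subst (K ∣_) (*-comm d S) K∣d*S))

  *S-%-injective : ∀ {k k′} → k < d → k′ < d → k * S % K ≡ k′ * S % K → k ≡ k′
  *S-%-injective {k} {k′} k<d k′<d eq = ≤-antisym (≤-from k<d eq) (≤-from k′<d (sym eq))
    where
    ≤-from : ∀ {a b} → a < d → a * S % K ≡ b * S % K → a ≤ b
    ≤-from {a} {b} a<d eq = m∸n≡0⇒m≤n (<-order⇒≡0 (≤-<-trans (m∸n≤m a b) a<d)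
      (subst (K ∣_) (sym (*-distribʳ-∸ S a b)) (%≡%⇒∣∸ (a * S) (b * S) K eq)))

module BlockResidues {K d q S : ℕ} .{{_ : NonZero K}} .{{_ : NonZero q}}
  (K≡q*d : K ≡ q * d) (q∣S : q ∣ S)
  (*S-%-injective : ∀ {k k′} → k < d → k′ < d → k * S % K ≡ k′ * S % K → k ≡ k′) (c : ℕ) where

  residue : ℕ → ℕ
  residue x = (x / q * S + (x % q + c)) % K

  residue-block : ∀ k {i} → i < q → residue (k * q + i) ≡ (i + (k * S + c)) % K
  residue-block k {i} i<q = begin
    residue (k * q + i)            ≡⟨ cong₂ (λ b r → (b * S + (r + c)) % K) quot rem ⟩
    (k * S + (i + c)) % K          ≡⟨ cong (_% K) (x∙yz≈y∙xz (k * S) i c) ⟩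
    (i + (k * S + c)) % K          ∎
    where
    rem : (k * q + i) % q ≡ i
    rem = trans (cong (_% q) (+-comm (k * q) i)) (trans ([m+kn]%n≡m%n i k q) (m<n⇒m%n≡m i<q))
    quot : (k * q + i) / q ≡ k
    quot = trans (+-distrib-/-∣ˡ i (n∣m*n k)) (trans (cong₂ _+_ (m*n/n≡m k q) (m<n⇒m/n≡0 i<q)) (+-identityʳ k))

  residue%q : ∀ x → residue x % q ≡ (x % q + c) % q
  residue%q x = trans (m∣n⇒o%n%m≡o%m q K _ (subst (q ∣_) (sym K≡q*d) (m∣m*n d)))
                      (%-remove-+ˡ (x % q + c) (∣n⇒∣m*n (x / q) q∣S))

  residue-injective : ∀ {x y} → x < K → y < K → residue x ≡ residue y → x ≡ y
  residue-injective {x} {y} x<K y<K eq = begin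
    x                   ≡⟨ m≡m%n+[m/n]*n x q ⟩
    x % q + x / q * q   ≡⟨ cong₂ (λ r b → r + b * q) rem≡ quot≡ ⟩
    y % q + y / q * q   ≡⟨ m≡m%n+[m/n]*n y q ⟨
    y                   ∎
    where
    rem≡ : x % q ≡ y % q
    rem≡ = begin
      x % q       ≡⟨ m%n%n≡m%n x q ⟨
      x % q % q   ≡⟨ %-cancelʳ-+ c (x % q) (y % q) q (trans (sym (residue%q x)) (trans (cong (_% q) eq) (residue%q y))) ⟩
      y % q % q   ≡⟨ m%n%n≡m%n y q ⟩
      y % q       ∎
    quot<d : ∀ {z} → z < K → z / q < d
    quot<d {z} z<K = m<n*o⇒m/o<n (subst (z <_) (trans K≡q*d (*-comm q d)) z<K)
    quot≡ : x / q ≡ y / q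
    quot≡ = *S-%-injective (quot<d x<K) (quot<d y<K)
      (%-cancelʳ-+ (x % q + c) _ _ K (trans eq (cong (λ r → (y / q * S + (r + c)) % K) (sym rem≡))))

  block-fibre≡1 : ∀ w → w < K →
    sumBelow d (λ k → sumBelow q (λ i → indicator ((i + (k * S + c)) % K ≟ w))) ≡ 1
  block-fibre≡1 w w<K = begin
    sumBelow d (λ k → sumBelow q (λ i → indicator ((i + (k * S + c)) % K ≟ w)))
      ≡⟨ sumBelow-cong d (λ k _ → sumBelow-cong q (λ i i<q →
           cong (λ v → indicator (v ≟ w)) (sym (residue-block k i<q)))) ⟩
    sumBelow d (λ k → sumBelow q (λ i → indicator (residue (k * q + i) ≟ w)))
      ≡⟨ sumBelow-blocks d q (λ x → indicator (residue x ≟ w)) ⟨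
    sumBelow (d * q) (λ x → indicator (residue x ≟ w))
      ≡⟨ cong (λ n → sumBelow n (λ x → indicator (residue x ≟ w))) (trans (*-comm d q) (sym K≡q*d)) ⟩
    sumBelow K (λ x → indicator (residue x ≟ w))
      ≡⟨ injective⇒fibre≡1 K residue (λ x _ → m%n<n _ K) residue-injective w w<K ⟩
    1 ∎

differences : ∀ {K m} .{{_ : NonZero K}} → Str K (suc m) → Str K m
differences {K} ω t = fromℕ< (⊖<K (toℕ (ω (Fin.suc t))) (toℕ (ω (inject₁ t))))
  where open Residues K

IsIntegralOf : ∀ {K n L} .{{_ : NonZero K}} .{{_ : NonZero n}} .{{_ : NonZero L}} →
  Necklace K n → Necklace K L → Set
IsIntegralOf {K} γ β = ∀ x → toℕ (at γ (suc x)) ≡ (toℕ (at γ x) + toℕ (at β (suc x))) % K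

integral-occursAt⇔ : ∀ {K n L m} .{{_ : NonZero K}} .{{_ : NonZero n}} .{{_ : NonZero L}}
  {γ : Necklace K n} {β : Necklace K L} → IsIntegralOf γ β → (ω : Str K (suc m)) → ∀ j →
  OccursAt γ ω j ⇔ (at γ j ≡ ω Fin.zero × OccursAt β (differences ω) (suc j))
integral-occursAt⇔ {K} {γ = γ} {β} integral ω j = mk⇔
  (λ occ → subst (λ x → at γ x ≡ ω Fin.zero) (+-identityʳ j) (occ Fin.zero) ,
           λ t → toℕ-injective (differences-occur occ t))
  (λ (start , diffs) → <-weakInduction (λ t → at γ (j + toℕ t) ≡ ω t)
    (subst (λ x → at γ x ≡ ω Fin.zero) (sym (+-identityʳ j)) start)
    (λ t prev → toℕ-injective (extend t prev diffs)))
  where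
  open Residues K

  next : ∀ t → toℕ (at γ (j + suc t)) ≡ (toℕ (at γ (j + t)) + toℕ (at β (suc j + t))) % K
  next t = trans (cong (λ x → toℕ (at γ x)) (+-suc j t)) (integral (j + t))

  at-inject₁ : ∀ {t} → at γ (j + toℕ (inject₁ t)) ≡ ω (inject₁ t) → at γ (j + toℕ t) ≡ ω (inject₁ t)
  at-inject₁ {t} = subst (λ x → at γ (j + x) ≡ ω (inject₁ t)) (toℕ-inject₁ t)

  differences-occur : OccursAt γ ω j → ∀ t → toℕ (at β (suc j + toℕ t)) ≡ toℕ (differences ω t)
  differences-occur occ t = trans ([m+o]%K≡n⇒o≡n⊖m (toℕ<n _) (toℕ<n _) (begin
      (toℕ (ω (inject₁ t)) + toℕ (at β (suc j + toℕ t))) % K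
        ≡⟨ cong (λ a → (toℕ a + _) % K) (at-inject₁ (occ (inject₁ t))) ⟨
      (toℕ (at γ (j + toℕ t)) + toℕ (at β (suc j + toℕ t))) % K
        ≡⟨ next (toℕ t) ⟨
      toℕ (at γ (j + suc (toℕ t)))
        ≡⟨ cong toℕ (occ (Fin.suc t)) ⟩
      toℕ (ω (Fin.suc t))
        ∎))
    (sym (toℕ-fromℕ< _))

  extend : ∀ t → at γ (j + toℕ (inject₁ t)) ≡ ω (inject₁ t) → OccursAt β (differences ω) (suc j) →
    toℕ (at γ (j + suc (toℕ t))) ≡ toℕ (ω (Fin.suc t))
  extend t prev diffs = begin
    toℕ (at γ (j + suc (toℕ t)))
      ≡⟨ next (toℕ t) ⟩
    (toℕ (at γ (j + toℕ t)) + toℕ (at β (suc j + toℕ t))) % K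
      ≡⟨ cong₂ (λ a b → (toℕ a + toℕ b) % K) (at-inject₁ prev) (diffs t) ⟩
    (toℕ (ω (inject₁ t)) + toℕ (differences ω t)) % K
      ≡⟨ cong (λ b → (toℕ (ω (inject₁ t)) + b) % K) (toℕ-fromℕ< _) ⟩
    (toℕ (ω (inject₁ t)) + (toℕ (ω (Fin.suc t)) ⊖ toℕ (ω (inject₁ t)))) % K
      ≡⟨ m+[n⊖m]≡n (toℕ<n _) (toℕ<n _) ⟩
    toℕ (ω (Fin.suc t))
      ∎

at-periodic : ∀ {K n} .{{_ : NonZero n}} (γ : Necklace K n) k y → at γ (k * n + y) ≡ at γ y
at-periodic {n = n} γ k y = cong γ (toℕ-injective (begin
  toℕ (fromℕ< (m%n<n (k * n + y) n)) ≡⟨ toℕ-fromℕ< _ ⟩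
  (k * n + y) % n                    ≡⟨ cong (_% n) (+-comm (k * n) y) ⟩
  (y + k * n) % n                    ≡⟨ [m+kn]%n≡m%n y k n ⟩
  y % n                              ≡⟨ toℕ-fromℕ< _ ⟨
  toℕ (fromℕ< (m%n<n y n))           ∎))

occursAt-periodic : ∀ {K n m} .{{_ : NonZero n}} (γ : Necklace K n) (ω : Str K m) k y →
  OccursAt γ ω (k * n + y) ⇔ OccursAt γ ω y
occursAt-periodic {n = n} γ ω k y = mk⇔
  (λ occ t → trans (sym (at-shift t)) (occ t))
  (λ occ t → trans (at-shift t) (occ t))
  where
  at-shift : ∀ t → at γ (k * n + y + toℕ t) ≡ at γ (y + toℕ t)
  at-shift t = trans (cong (at γ) (+-assoc (k * n) y (toℕ t))) (at-periodic γ k (y + toℕ t))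

module _ {K L : ℕ} .{{_ : NonZero K}} .{{_ : NonZero L}} (β : Necklace K L) where

  prefixSum : ℕ → ℕ
  prefixSum x = sumBelow x (λ j → toℕ (at β j))

  prefixSum-periodic : ∀ k y → prefixSum (k * L + y) ≡ k * necklaceSum β + prefixSum y
  prefixSum-periodic zero    y = refl
  prefixSum-periodic (suc k) y = begin
    prefixSum ((L + k * L) + y)
      ≡⟨ cong prefixSum (+-assoc L (k * L) y) ⟩
    prefixSum (L + (k * L + y))
      ≡⟨ sumBelow-+ L (k * L + y) _ ⟩
    necklaceSum β + sumBelow (k * L + y) (λ u → toℕ (at β (L + u)))
      ≡⟨ cong (necklaceSum β +_) (sumBelow-cong (k * L + y) at-L+) ⟩
    necklaceSum β + prefixSum (k * L + y)
      ≡⟨ cong (necklaceSum β +_) (prefixSum-periodic k y) ⟩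
    necklaceSum β + (k * necklaceSum β + prefixSum y)
      ≡⟨ +-assoc (necklaceSum β) _ _ ⟨
    (necklaceSum β + k * necklaceSum β) + prefixSum y
      ∎
    where
    at-L+ : ∀ u → u < k * L + y → toℕ (at β (L + u)) ≡ toℕ (at β u)
    at-L+ u _ = cong toℕ (trans (cong (λ l → at β (l + u)) (sym (*-identityˡ L))) (at-periodic β 1 u))

module Lift {K L d : ℕ} .{{_ : NonZero K}} .{{_ : NonZero L}} .{{_ : NonZero d}}
  (β : Necklace K L) (K∣d*S : K ∣ d * necklaceSum β) where

  private instance
    d*L≢0 : NonZero (d * L)
    d*L≢0 = m*n≢0 d L

  S : ℕ
  S = necklaceSum β

  -- K ∣ d·S makes the running sum periodic modulo K with period dL.
  at-lift : ∀ i x → toℕ (at (liftNecklace K L d β i) x) ≡ (i + prefixSum β (suc x)) % K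
  at-lift i x = begin
    toℕ (at (liftNecklace K L d β i) x)                   ≡⟨ toℕ-fromℕ< _ ⟩
    (i + prefixSum β (suc (toℕ (fromℕ< (m%n<n x (d * L)))))) % K
      ≡⟨ cong (λ r → (i + prefixSum β (suc r)) % K) (toℕ-fromℕ< _) ⟩
    (i + prefixSum β (suc r)) % K                         ≡⟨ %-remove-+ʳ _ (∣n⇒∣m*n Q K∣d*S) ⟨
    (i + prefixSum β (suc r) + Q * (d * S)) % K           ≡⟨ cong (_% K) (x∙yz≈xz∙y i (Q * (d * S)) _) ⟨
    (i + (Q * (d * S) + prefixSum β (suc r))) % K         ≡⟨ cong (λ p → (i + p) % K) prefixSum-suc-x ⟨
    (i + prefixSum β (suc x)) % K                         ∎
    where
    r Q : ℕ
    r = x % (d * L)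
    Q = x / (d * L)
    prefixSum-suc-x : prefixSum β (suc x) ≡ Q * (d * S) + prefixSum β (suc r)
    prefixSum-suc-x = begin
      prefixSum β (suc x)
        ≡⟨ cong (prefixSum β ∘ suc) (trans (m≡m%n+[m/n]*n x (d * L)) (+-comm r _)) ⟩
      prefixSum β (suc (Q * (d * L) + r))
        ≡⟨ cong (prefixSum β) (trans (sym (+-suc _ r)) (cong (_+ suc r) (sym (*-assoc Q d L)))) ⟩
      prefixSum β (Q * d * L + suc r)
        ≡⟨ prefixSum-periodic β (Q * d) (suc r) ⟩
      Q * d * S + prefixSum β (suc r)
        ≡⟨ cong (_+ prefixSum β (suc r)) (*-assoc Q d S) ⟩
      Q * (d * S) + prefixSum β (suc r)
        ∎

  lift-isIntegral : ∀ i → IsIntegralOf (liftNecklace K L d β i) β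
  lift-isIntegral i x = begin
    toℕ (at (liftNecklace K L d β i) (suc x))
      ≡⟨ at-lift i (suc x) ⟩
    (i + (prefixSum β (suc x) + toℕ (at β (suc x)))) % K
      ≡⟨ cong (_% K) (+-assoc i _ _) ⟨
    (i + prefixSum β (suc x) + toℕ (at β (suc x))) % K
      ≡⟨ [m%k+n]%k≡[m+n]%k _ _ K ⟨
    ((i + prefixSum β (suc x)) % K + toℕ (at β (suc x))) % K
      ≡⟨ cong (λ a → (a + toℕ (at β (suc x))) % K) (at-lift i x) ⟨
    (toℕ (at (liftNecklace K L d β i) x) + toℕ (at β (suc x))) % K
      ∎

  occ-lift : ∀ i {m} (ω : Str K (suc m)) → occ (liftNecklace K L d β i) ω ≡
    sumBelow (d * L) (λ j → indicator ((i + prefixSum β (suc j)) % K ≟ toℕ (ω Fin.zero))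
                          * indicator (occursAt? β (differences ω) (suc j)))
  occ-lift i ω = trans (count≡sumBelow-indicator (d * L) _ _)
    (sumBelow-cong (d * L) (λ j _ → indicator-× (occursAt? (liftNecklace K L d β i) ω j) (_ ≟ _)
                                                 (occursAt? β (differences ω) (suc j)) (occursAt⇔ j)))
    where
    occursAt⇔ : ∀ j → OccursAt (liftNecklace K L d β i) ω j ⇔
      ((i + prefixSum β (suc j)) % K ≡ toℕ (ω Fin.zero) × OccursAt β (differences ω) (suc j))
    occursAt⇔ j = mk⇔
      (λ occ → let (start , diffs) = Equivalence.to occ⇔ occ in trans (sym (at-lift i j)) (cong toℕ start) , diffs)
      (λ (start , diffs) → Equivalence.from occ⇔ (toℕ-injective (trans (at-lift i j) start) , diffs))
      where
      occ⇔ : OccursAt (liftNecklace K L d β i) ω j ⇔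
        (at (liftNecklace K L d β i) j ≡ ω Fin.zero × OccursAt β (differences ω) (suc j))
      occ⇔ = integral-occursAt⇔ {γ = liftNecklace K L d β i} {β = β} (lift-isIntegral i) ω j

liftOcc≡occ-differences : ∀ {K L d m} .{{_ : NonZero K}} .{{_ : NonZero L}} .{{_ : NonZero d}}
  (β : Necklace K L) → IsLiftDegree β d → (ω : Str K (suc m)) →
  liftOcc K L d β ω ≡ occ β (differences ω)
liftOcc≡occ-differences {K} {L} {d} β ((_ , K∣d*S) , least) ω = begin
  liftOcc K L d β ω
    ≡⟨ sumBelow-cong q (λ i _ → occ-lift i ω) ⟩
  sumBelow q (λ i → sumBelow (d * L) (λ j → starts i j * diffOcc (suc j)))
    ≡⟨ sumBelow-comm q (d * L) _ ⟩
  sumBelow (d * L) (λ j → sumBelow q (λ i → starts i j * diffOcc (suc j)))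
    ≡⟨ sumBelow-cong (d * L) (λ j _ → sumBelow-*ʳ q (λ i → starts i j) (diffOcc (suc j))) ⟩
  sumBelow (d * L) (λ j → sumBelow q (λ i → starts i j) * diffOcc (suc j))
    ≡⟨ sumBelow-blocks d L _ ⟩
  sumBelow d (λ k → sumBelow L (λ r → sumBelow q (λ i → starts i (k * L + r)) * diffOcc (suc (k * L + r))))
    ≡⟨ sumBelow-cong d (λ k _ → sumBelow-cong L (λ r _ → cong₂ _*_ (starts-periodic k r) (diffOcc-periodic k r))) ⟩
  sumBelow d (λ k → sumBelow L (λ r → blockStarts k r * diffOcc (suc r)))
    ≡⟨ sumBelow-comm d L _ ⟩
  sumBelow L (λ r → sumBelow d (λ k → blockStarts k r * diffOcc (suc r)))
    ≡⟨ sumBelow-cong L (λ r _ → trans (sumBelow-*ʳ d (λ k → blockStarts k r) (diffOcc (suc r)))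
                                       (trans (cong (_* diffOcc (suc r)) (blockStarts-total≡1 r)) (*-identityˡ _))) ⟩
  sumBelow L (λ r → diffOcc (suc r))
    ≡⟨ sumBelow-shift L diffOcc diffOcc-L≡diffOcc-0 ⟩
  sumBelow L diffOcc
    ≡⟨ count≡sumBelow-indicator L _ _ ⟨
  occ β (differences ω)
    ∎
  where
  open Lift β K∣d*S
  open AdditiveOrder K∣d*S least
  open BlockResidues using (block-fibre≡1)

  q : ℕ
  q = K / d

  w : ℕ
  w = toℕ (ω Fin.zero)

  diffOcc : ℕ → ℕ
  diffOcc r = indicator (occursAt? β (differences ω) r)

  starts : ℕ → ℕ → ℕ
  starts i j = indicator ((i + prefixSum β (suc j)) % K ≟ w)

  blockStarts : ℕ → ℕ → ℕ
  blockStarts k r = sumBelow q (λ i → indicator ((i + (k * S + prefixSum β (suc r))) % K ≟ w))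

  starts-periodic : ∀ k r → sumBelow q (λ i → starts i (k * L + r)) ≡ blockStarts k r
  starts-periodic k r = sumBelow-cong q (λ i _ → cong (λ p → indicator ((i + p) % K ≟ w))
    (trans (cong (prefixSum β) (sym (+-suc (k * L) r))) (prefixSum-periodic β k (suc r))))

  diffOcc-periodic : ∀ k r → diffOcc (suc (k * L + r)) ≡ diffOcc (suc r)
  diffOcc-periodic k r = trans (cong diffOcc (sym (+-suc (k * L) r)))
    (indicator-cong (occursAt? β _ _) (occursAt? β _ _) (occursAt-periodic β (differences ω) k (suc r)))

  diffOcc-L≡diffOcc-0 : diffOcc L ≡ diffOcc 0
  diffOcc-L≡diffOcc-0 = trans (cong diffOcc (sym (trans (+-identityʳ _) (*-identityˡ L))))
    (indicator-cong (occursAt? β _ _) (occursAt? β _ _) (occursAt-periodic β (differences ω) 1 0))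

  blockStarts-total≡1 : ∀ r → sumBelow d (λ k → blockStarts k r) ≡ 1
  blockStarts-total≡1 r =
    block-fibre≡1 K≡[K/d]*d [K/d]∣S *S-%-injective (prefixSum β (suc r)) w (toℕ<n (ω Fin.zero))

lemma2 : (K L : ℕ) .{{_ : NonZero K}} .{{_ : NonZero L}} → 2 ≤ K →
    (α : Necklace K L) → IsPSeq K L α →
    (d : ℕ) .{{_ : NonZero d}} → IsLiftDegree α d →
    (m : ℕ) → 1 ≤ m → m ≤ L → (ω : Str K m) →
    FloorOrCeil (liftOcc K L d α ω) L (K ^ (m ∸ 1)) {{m^n≢0 K (m ∸ 1)}}
lemma2 K L _ α isPSeq d isLiftDegree (suc m) _ 1+m≤L ω =
  subst (λ n → FloorOrCeil n L (K ^ m) {{m^n≢0 K m}}) (sym (liftOcc≡occ-differences α isLiftDegree ω))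
    (isPSeq m (≤-trans (n≤1+n m) 1+m≤L) (differences ω))
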